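{- Let $\mathbb{F}$ be a finite field, let $u\in\mathbb{F}$, and let $$g_u(t)=t^{ -1}\prod_{i=0}^{\infty}\bigl(1+u\,t^{ -2^i}\bigr)\in\mathbb{F}((t^{ -1})),$$ the Laurent series solution of $g_u(t)=(t+u)\,g_u(t^2)$. Then $g_u\notin\mathbf{ELC}$.
   Context: For $\alpha=\sum_{k=-h}^{\infty}a_kt^{ -k}\in\mathbb{F}((t^{ -1}))$ with $a_{ -h}\neq0$, put $|\alpha|=2^h$ (and $|0|=0$). Define $\|\alpha\|=\min_{p\in\mathbb{F}[t]}|\alpha-p|=\bigl|\sum_{k\ge1}a_kt^{ -k}\bigr|$. $\mathbf{ELC}$ is the set of $\alpha\in\mathbb{F}((t^{ -1}))$ such that $\inf_{q\in\mathbb{F}[t]\setminus\{0\},\,k\ge0}|q|\cdot\|q\,t^k\alpha\|>0$, i.e. the set of counterexamples to the $t$-adic Littlewood conjecture. -}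

module Defs where

open import Level using (Level; _⊔_)
open import Algebra.Bundles using (CommutativeRing)
open import Data.Nat using (ℕ; zero; suc; _∸_; _^_; _≟_) renaming (_+_ to _+ℕ_; _≤_ to _≤ℕ_)
open import Data.Integer using (ℤ; +_; -[1+_]) renaming (_<_ to _<ℤ_; -_ to -ℤ_)
open import Data.List using (List; map; foldr; upTo)
open import Data.List.Relation.Unary.Any using (Any)
open import Data.Product using (Σ; ∃; _×_)
open import Data.Bool using (if_then_else_)
open import Relation.Nullary using (¬_)
open import Relation.Nullary.Decidable using (⌊_⌋)

module _ {c ℓ : Level} (F : CommutativeRing c ℓ) where
  open CommutativeRing F

  IsField : Set (c ⊔ ℓ)
  IsField = (¬ (0# ≈ 1#)) × (∀ x → ¬ (x ≈ 0#) → ∃ λ y → x * y ≈ 1#)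

  Finite : Set (c ⊔ ℓ)
  Finite = Σ (List Carrier) λ xs → ∀ x → Any (x ≈_) xs

  sumTo : ℕ → (ℕ → Carrier) → Carrier
  sumTo n f = foldr _+_ 0# (map f (upTo (suc n)))

  -- Laurent series in t⁻¹: coeff k is the coefficient of t^(-k);
  -- only finitely many positive powers of t occur.
  record Laurent : Set (c ⊔ ℓ) where
    field
      coeff   : ℤ → Carrier
      bounded : ∃ λ (h : ℕ) → ∀ k → k <ℤ -ℤ (+ h) → coeff k ≈ 0#

  conv : (ℕ → Carrier) → (ℕ → Carrier) → (ℕ → Carrier)
  conv a b n = sumTo n (λ j → a j * b (n ∸ j))

  one : ℕ → Carrier
  one zero    = 1#
  one (suc _) = 0#

  factor : Carrier → ℕ → (ℕ → Carrier)
  factor u i zero    = 1#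
  factor u i (suc n) = if ⌊ suc n ≟ 2 ^ i ⌋ then u else 0#

  partialProd : Carrier → ℕ → (ℕ → Carrier)
  partialProd u zero    = one
  partialProd u (suc N) = conv (partialProd u N) (factor u N)

  -- coefficient of x^n in the infinite product ∏_{i≥0}(1 + u x^(2^i)):
  -- factors with 2^i > n do not affect it, so the product up to i = n suffices.
  infProdCoeff : Carrier → ℕ → Carrier
  infProdCoeff u n = partialProd u (suc n) n

  -- g_u = t⁻¹ ∏_{i≥0} (1 + u t^(-2^i)), so coefficient of t^(-(n+1)) is infProdCoeff u n.
  gCoeff : Carrier → ℤ → Carrier
  gCoeff u (+ zero)    = 0#
  gCoeff u (+ (suc n)) = infProdCoeff u n
  gCoeff u -[1+ _ ]    = 0#

  g : Carrier → Laurent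
  g u = record { coeff = gCoeff u ; bounded = 0 , bnd }
    where
      open import Data.Product using (_,_)
      bnd : ∀ k → k <ℤ -ℤ (+ 0) → gCoeff u k ≈ 0#
      bnd (+ zero)    _ = refl
      bnd (+ (suc n)) (Data.Integer.+<+ ())
      bnd -[1+ _ ]    _ = refl

  -- For a polynomial q = Σ_{j≤d} q j t^j and k ≥ 0, the coefficient of t^(-m) (m ≥ 1)
  -- in q t^k α.
  fracCoeff : (ℕ → Carrier) → ℕ → ℕ → Laurent → ℕ → Carrier
  fracCoeff q d k α m = sumTo d (λ j → q j * Laurent.coeff α (+ (m +ℕ j +ℕ k)))

  -- α ∈ ELC  iff  inf_{q≠0, k≥0} |q|·‖q t^k α‖ > 0.
  -- Since all these values are in {0} ∪ 2^ℤ, this holds iff there is M with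
  -- |q|·‖q t^k α‖ ≥ 2^(-M) for all q ≠ 0 (degree d, q d ≠ 0) and k ≥ 0, i.e.
  -- some coefficient of t^(-m), 1 ≤ m ≤ d + M, in q t^k α is nonzero.
  ELC : Laurent → Set (c ⊔ ℓ)
  ELC α = ∃ λ (M : ℕ) → ∀ (d : ℕ) (q : ℕ → Carrier) → ¬ (q d ≈ 0#) → ∀ (k : ℕ) →
            ∃ λ (m : ℕ) → 1 ≤ℕ m × m ≤ℕ d +ℕ M × ¬ (fracCoeff q d k α m ≈ 0#)

{-# OPTIONS --safe #-}
-- The coefficient A n of t^-(n+1) in g_u is u to the binary digit sum of n, so
-- A (2^s·x + j) = A x · A j for j < 2^s. In a finite field u = u^(v+2) for some v; at
-- x = 2(2^v − 1) the values A x, A (x+1), A (x+2) are u^v, u^(v+1), u, each u times the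
-- previous one, and hence A (i + D) = u · A i for D·x ≤ i < D·x + 2D, D = 2^M. So for
-- q = t^D − u and k = D·x the first 2D fractional coefficients of q t^k g_u vanish:
-- |q|·‖q t^k g_u‖ ≤ 2^(−D−1), which beats any bound 2^(−M) since 2^M > M.
module Submission where

open import Defs
open import Level using (Level)
open import Algebra.Bundles using (CommutativeRing; Semiring)
open import Data.Nat using (ℕ; zero; suc; _+_; _*_; _^_; _∸_; _≤_; _<_; _≟_; _<?_; s≤s; z≤n)
import Data.Nat.Properties as ℕ
open import Data.Nat.Tactic.RingSolver using (solve-∀)
open import Data.Fin using (Fin; toℕ)
open import Data.Fin.Properties using (toℕ<n; toℕ≤pred[n]; pigeonhole)
import Data.Integer as ℤ
open import Data.Bool using (if_then_else_)
open import Relation.Nullary.Decidable using (⌊_⌋)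
open import Data.Product using (∃; ∃₂; _×_; _,_)
open import Data.List using (foldr; map; applyUpTo; length; lookup)
open import Data.List.Relation.Unary.Any using (index)
open import Data.List.Relation.Unary.Any.Properties using (lookup-index)
open import Data.Sum using (_⊎_; inj₁; inj₂)
open import Function using (_∘_; id)
open import Relation.Nullary using (¬_; yes; no)
open import Relation.Nullary.Negation using (contradiction)
open import Relation.Binary.PropositionalEquality as ≡ using (_≡_; _≢_)

2^suc≡2^+2^ : ∀ N → 2 ^ suc N ≡ 2 ^ N + 2 ^ N
2^suc≡2^+2^ N = ≡.cong (2 ^ N +_) (ℕ.+-identityʳ (2 ^ N))

n<2^n : ∀ n → n < 2 ^ n
n<2^n zero    = s≤s z≤n
n<2^n (suc n) =
  ≡.subst (suc n <_) (≡.sym (2^suc≡2^+2^ n)) (ℕ.≤-<-trans (n<2^n n) (ℕ.m<m+n (2 ^ n) (ℕ.m^n>0 2 n)))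

2^n≢0 : ∀ n → 2 ^ n ≢ 0
2^n≢0 n = ℕ.>⇒≢ (ℕ.m^n>0 2 n)

<-+-split : ∀ D {x} → x < D + D → x < D ⊎ ∃ λ y → y < D × D + y ≡ x
<-+-split D {x} x<D+D with x <? D
... | yes x<D = inj₁ x<D
... | no  x≮D = inj₂ (x ∸ D , ℕ.+-cancelˡ-< D _ _ (≡.subst (_< D + D) (≡.sym D+[x∸D]≡x) x<D+D) , D+[x∸D]≡x)
  where
    D+[x∸D]≡x : D + (x ∸ D) ≡ x
    D+[x∸D]≡x = ℕ.m+[n∸m]≡n (ℕ.≮⇒≥ x≮D)

mixed-radix-< : ∀ b {x X j} → x < X → j < b → b * x + j < b * X
mixed-radix-< b {x} {X} x<X j<b = ℕ.<-≤-trans (ℕ.+-monoʳ-< (b * x) j<b)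
  (≡.subst (_≤ b * X) (≡.trans (ℕ.*-suc b x) (ℕ.+-comm b (b * x))) (ℕ.*-monoʳ-≤ b x<X))

2^[N+s]≡2^s*2^N : ∀ N s → 2 ^ (N + s) ≡ 2 ^ s * 2 ^ N
2^[N+s]≡2^s*2^N N s = ≡.trans (ℕ.^-distribˡ-+-* 2 N s) (ℕ.*-comm (2 ^ N) (2 ^ s))

digits-< : ∀ N s {x j} → x < 2 ^ N → j < 2 ^ s → 2 ^ s * x + j < 2 ^ (N + s)
digits-< N s x<2^N j<2^s =
  ≡.subst (_ <_) (≡.sym (2^[N+s]≡2^s*2^N N s)) (mixed-radix-< (2 ^ s) x<2^N j<2^s)

digits-+ : ∀ N s y j → 2 ^ s * (2 ^ N + y) + j ≡ 2 ^ (N + s) + (2 ^ s * y + j)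
digits-+ N s y j = ≡.trans (distrib (2 ^ N) (2 ^ s) y j) (≡.cong (_+ _) (≡.sym (2^[N+s]≡2^s*2^N N s)))
  where
    distrib : ∀ a b y j → b * (a + y) + j ≡ b * a + (b * y + j)
    distrib = solve-∀

allOnes : ℕ → ℕ
allOnes zero    = 0
allOnes (suc v) = 2 * allOnes v + 1

module _ {c ℓ : Level} (F : CommutativeRing c ℓ) where
  open CommutativeRing F
    renaming (_+_ to _⊕_; _*_ to _·_)
  open Laurent using (coeff)
  open import Algebra.Properties.Monoid.Sum +-monoid using (sum; sum-cong-≋; sum-replicate-zero)
  open import Algebra.Definitions.RawSemiring (Semiring.rawSemiring semiring) using () renaming (_^_ to _^ᶠ_)
  open import Relation.Binary.Reasoning.Setoid setoid

  sumTo≡sum : ∀ n f → sumTo F n f ≡ sum {suc n} (f ∘ toℕ)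
  sumTo≡sum n f = foldr-applyUpTo (suc n) id
    where
      foldr-applyUpTo : ∀ k (h : ℕ → ℕ) → foldr _⊕_ 0# (map f (applyUpTo h k)) ≡ sum {k} (f ∘ h ∘ toℕ)
      foldr-applyUpTo zero    h = ≡.refl
      foldr-applyUpTo (suc k) h = ≡.cong (f (h 0) ⊕_) (foldr-applyUpTo k (h ∘ suc))

  sum-zero : ∀ {n} (t : Fin n → Carrier) → (∀ i → t i ≈ 0#) → sum t ≈ 0#
  sum-zero {n} t t≈0 = trans (sum-cong-≋ t≈0) (sum-replicate-zero n)

  sum-single : ∀ {n} (f : ℕ → Carrier) {p} → p < n → (∀ j → j < n → j ≢ p → f j ≈ 0#) →
               sum {n} (f ∘ toℕ) ≈ f p
  sum-single {suc n} f {zero} _ off = begin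
    f 0 ⊕ sum {n} (f ∘ suc ∘ toℕ) ≈⟨ +-congˡ (sum-zero _ λ i → off (suc (toℕ i)) (s≤s (toℕ<n i)) λ ()) ⟩
    f 0 ⊕ 0#                      ≈⟨ +-identityʳ (f 0) ⟩
    f 0                           ∎
  sum-single {suc n} f {suc p} (s≤s p<n) off = begin
    f 0 ⊕ sum {n} (f ∘ suc ∘ toℕ) ≈⟨ +-cong (off 0 (s≤s z≤n) λ ()) (sum-single (f ∘ suc) p<n off-suc) ⟩
    0# ⊕ f (suc p)                ≈⟨ +-identityˡ (f (suc p)) ⟩
    f (suc p)                     ∎
    where
      off-suc : ∀ j → j < n → j ≢ p → f (suc j) ≈ 0#
      off-suc j j<n j≢p = off (suc j) (s≤s j<n) (j≢p ∘ ℕ.suc-injective)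

  binomial : ℕ → Carrier → ℕ → Carrier
  binomial D c zero    = - c
  binomial D c (suc j) = if ⌊ suc j ≟ D ⌋ then 1# else 0#

  binomial-leading : ∀ D c → D ≢ 0 → binomial D c D ≈ 1#
  binomial-leading zero    c D≢0 = contradiction ≡.refl D≢0
  binomial-leading (suc D) c _ with suc D ≟ suc D
  ... | yes _ = refl
  ... | no  D≢D = contradiction ≡.refl D≢D

  binomial-middle : ∀ {D} c {j} → j ≢ 0 → j ≢ D → binomial D c j ≈ 0#
  binomial-middle c {zero} j≢0 _ = contradiction ≡.refl j≢0
  binomial-middle {D} c {suc j} _ j≢D with suc j ≟ D
  ... | yes j≡D = contradiction j≡D j≢D
  ... | no  _   = refl

  fracCoeff-binomial : ∀ {D} c k α m → D ≢ 0 →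
                       fracCoeff F (binomial D c) D k α m ≈ coeff α (ℤ.+ (m + D + k)) - c · coeff α (ℤ.+ (m + k))
  fracCoeff-binomial {zero}  c k α m D≢0 = contradiction ≡.refl D≢0
  fracCoeff-binomial {suc D} c k α m _ = begin
    sumTo F (suc D) term                           ≡⟨ sumTo≡sum (suc D) term ⟩
    term 0 ⊕ sum {suc D} (term ∘ suc ∘ toℕ)        ≈⟨ +-congˡ (sum-single (term ∘ suc) (ℕ.n<1+n D) middle) ⟩
    term 0 ⊕ term (suc D)                          ≈⟨ +-comm _ _ ⟩
    term (suc D) ⊕ term 0                          ≈⟨ +-cong leading constant ⟩
    X (m + suc D + k) - c · X (m + k)              ∎
    where
      open import Algebra.Properties.Ring ring using (-‿distribˡ-*)
      X : ℕ → Carrier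
      X i = coeff α (ℤ.+ i)
      term : ℕ → Carrier
      term j = binomial (suc D) c j · X (m + j + k)
      leading : term (suc D) ≈ X (m + suc D + k)
      leading = trans (*-congʳ (binomial-leading (suc D) c λ ())) (*-identityˡ _)
      constant : term 0 ≈ - (c · X (m + k))
      constant = trans (sym (-‿distribˡ-* c _)) (-‿cong (reflexive (≡.cong (λ i → c · X (i + k)) (ℕ.+-identityʳ m))))
      middle : ∀ j → j < suc D → j ≢ D → term (suc j) ≈ 0#
      middle j j<1+D j≢D = trans (*-congʳ (binomial-middle c (λ ()) (j≢D ∘ ℕ.suc-injective))) (zeroˡ _)

  power-repeats : Finite F → ∀ x → ∃₂ λ a p → x ^ᶠ a ≈ x ^ᶠ (a + suc p)
  power-repeats (xs , enumerates) x with pigeonhole (ℕ.n<1+n (length xs)) (index ∘ enumerates ∘ (x ^ᶠ_) ∘ toℕ)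
  ... | i , j , i<j , same-index = toℕ i , toℕ j ∸ suc (toℕ i) , (begin
    x ^ᶠ toℕ i                                  ≈⟨ lookup-index (enumerates (x ^ᶠ toℕ i)) ⟩
    lookup xs (index (enumerates (x ^ᶠ toℕ i))) ≡⟨ ≡.cong (lookup xs) same-index ⟩
    lookup xs (index (enumerates (x ^ᶠ toℕ j))) ≈⟨ lookup-index (enumerates (x ^ᶠ toℕ j)) ⟨
    x ^ᶠ toℕ j                                  ≡⟨ ≡.cong (x ^ᶠ_) j≡i+[1+p] ⟩
    x ^ᶠ (toℕ i + suc (toℕ j ∸ suc (toℕ i)))    ∎)
    where
      j≡i+[1+p] : toℕ j ≡ toℕ i + suc (toℕ j ∸ suc (toℕ i))
      j≡i+[1+p] = ≡.trans (≡.sym (ℕ.m+[n∸m]≡n i<j)) (≡.sym (ℕ.+-suc (toℕ i) _))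

  unit-power-cancel : ∀ {x w} → x · w ≈ 1# → ∀ a {b} → x ^ᶠ a ≈ x ^ᶠ (a + b) → 1# ≈ x ^ᶠ b
  unit-power-cancel x·w≈1 zero    xᵃ≈xᵃ⁺ᵇ = xᵃ≈xᵃ⁺ᵇ
  unit-power-cancel {x} {w} x·w≈1 (suc a) xᵃ⁺¹≈xᵃ⁺ᵇ⁺¹ =
    unit-power-cancel x·w≈1 a (trans (sym (cancel _)) (trans (*-congˡ xᵃ⁺¹≈xᵃ⁺ᵇ⁺¹) (cancel _)))
    where
      cancel : ∀ y → w · (x · y) ≈ y
      cancel y = trans (sym (*-assoc w x y)) (trans (*-congʳ (trans (*-comm w x) x·w≈1)) (*-identityˡ y))

  -- Constructively we cannot decide whether x ≈ 0, hence the double negation.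
  finite-field-power-periodic : IsField F → Finite F → ∀ x → ¬ ¬ ∃ λ v → x ≈ x ^ᶠ (2 + v)
  finite-field-power-periodic (_ , inverse) finite x no-v =
    no-v (nonzero-case λ x≈0 → no-v (0 , zero-case x≈0))
    where
      zero-case : x ≈ 0# → x ≈ x ^ᶠ 2
      zero-case x≈0 = trans x≈0 (sym (trans (*-congʳ x≈0) (zeroˡ _)))

      nonzero-case : ¬ x ≈ 0# → ∃ λ v → x ≈ x ^ᶠ (2 + v)
      nonzero-case x≉0 with inverse x x≉0 | power-repeats finite x
      ... | w , x·w≈1 | a , p , xᵃ≈xᵃ⁺ᵖ⁺¹ = p , (begin
        x                 ≈⟨ *-identityʳ x ⟨
        x · 1#            ≈⟨ *-congˡ (unit-power-cancel x·w≈1 a xᵃ≈xᵃ⁺ᵖ⁺¹) ⟩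
        x · x ^ᶠ suc p    ∎)

  module _ (u : Carrier) where
    private
      P : ℕ → ℕ → Carrier
      P = partialProd F u

    factor-off : ∀ N {m} → m ≢ 0 → m ≢ 2 ^ N → factor F u N m ≈ 0#
    factor-off N {zero}  m≢0 _ = contradiction ≡.refl m≢0
    factor-off N {suc m} _ m≢2^N with suc m ≟ 2 ^ N
    ... | yes m≡2^N = contradiction m≡2^N m≢2^N
    ... | no  _     = refl

    factor-at : ∀ N {m} → m ≡ 2 ^ N → factor F u N m ≈ u
    factor-at N {zero}  0≡2^N = contradiction (≡.sym 0≡2^N) (2^n≢0 N)
    factor-at N {suc m} m≡2^N with suc m ≟ 2 ^ N
    ... | yes _     = refl
    ... | no  m≢2^N = contradiction m≡2^N m≢2^N

    factor-term-zero : ∀ (a : ℕ → Carrier) N {n j} → j ≤ n → (j ≡ n → a j ≈ 0#) →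
                       (2 ^ N + j ≡ n → a j ≈ 0#) → a j · factor F u N (n ∸ j) ≈ 0#
    factor-term-zero a N {n} {j} j≤n at-n at-shift with n ∸ j ≟ 0 | n ∸ j ≟ 2 ^ N
    ... | yes d≡0 | _ = trans (*-congʳ (at-n (ℕ.≤-antisym j≤n (ℕ.m∸n≡0⇒m≤n d≡0)))) (zeroˡ _)
    ... | no _ | yes d≡2^N =
      trans (*-congʳ (at-shift (≡.trans (≡.cong (_+ j) (≡.sym d≡2^N)) (ℕ.m∸n+n≡m j≤n)))) (zeroˡ _)
    ... | no d≢0 | no d≢2^N = trans (*-congˡ (factor-off N d≢0 d≢2^N)) (zeroʳ _)

    partialProd-suc : ∀ N n → P (suc N) n ≡ sum {suc n} (λ i → P N (toℕ i) · factor F u N (n ∸ toℕ i))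
    partialProd-suc N n = sumTo≡sum n _

    partialProd-support : ∀ N {n} → 2 ^ N ≤ n → P N n ≈ 0#
    partialProd-support zero    {suc n} _ = refl
    partialProd-support (suc N) {n} 2^[1+N]≤n =
      trans (reflexive (partialProd-suc N n)) (sum-zero {suc n} _ λ i →
        factor-term-zero (P N) N (toℕ≤pred[n] i)
          (λ j≡n → partialProd-support N (≡.subst (2 ^ N ≤_) (≡.sym j≡n) (ℕ.≤-trans (ℕ.m≤m+n _ _) 2^N+2^N≤n)))
          (λ 2^N+j≡n → partialProd-support N
            (ℕ.+-cancelˡ-≤ (2 ^ N) _ _ (≡.subst (2 ^ N + 2 ^ N ≤_) (≡.sym 2^N+j≡n) 2^N+2^N≤n))))
      where
        2^N+2^N≤n : 2 ^ N + 2 ^ N ≤ n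
        2^N+2^N≤n = ≡.subst (_≤ n) (2^suc≡2^+2^ N) 2^[1+N]≤n

    partialProd-low : ∀ N {n} → n < 2 ^ N → P (suc N) n ≈ P N n
    partialProd-low N {n} n<2^N = begin
      P (suc N) n                       ≡⟨ partialProd-suc N n ⟩
      sum {suc n} (term ∘ toℕ)          ≈⟨ sum-single term (ℕ.n<1+n n) off ⟩
      P N n · factor F u N (n ∸ n)      ≡⟨ ≡.cong (λ d → P N n · factor F u N d) (ℕ.n∸n≡0 n) ⟩
      P N n · 1#                        ≈⟨ *-identityʳ (P N n) ⟩
      P N n                             ∎
      where
        term : ℕ → Carrier
        term j = P N j · factor F u N (n ∸ j)
        off : ∀ j → j < suc n → j ≢ n → term j ≈ 0#
        off j j<1+n j≢n = factor-term-zero (P N) N (ℕ.≤-pred j<1+n) (λ j≡n → contradiction j≡n j≢n)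
          (λ 2^N+j≡n → contradiction (≡.subst (2 ^ N ≤_) 2^N+j≡n (ℕ.m≤m+n _ _)) (ℕ.<⇒≱ n<2^N))

    partialProd-high : ∀ N {y} → y < 2 ^ N → P (suc N) (2 ^ N + y) ≈ P N y · u
    partialProd-high N {y} y<2^N = begin
      P (suc N) n                       ≡⟨ partialProd-suc N n ⟩
      sum {suc n} (term ∘ toℕ)          ≈⟨ sum-single term (s≤s (ℕ.m≤n+m y (2 ^ N))) off ⟩
      P N y · factor F u N (n ∸ y)      ≈⟨ *-congˡ (factor-at N (ℕ.m+n∸n≡m (2 ^ N) y)) ⟩
      P N y · u                         ∎
      where
        n = 2 ^ N + y
        term : ℕ → Carrier
        term j = P N j · factor F u N (n ∸ j)
        off : ∀ j → j < suc n → j ≢ y → term j ≈ 0#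
        off j j<1+n j≢y = factor-term-zero (P N) N (ℕ.≤-pred j<1+n)
          (λ j≡n → partialProd-support N (≡.subst (2 ^ N ≤_) (≡.sym j≡n) (ℕ.m≤m+n _ _)))
          (λ 2^N+j≡n → contradiction (ℕ.+-cancelˡ-≡ (2 ^ N) j y 2^N+j≡n) j≢y)

    partialProd-stable : ∀ {N K n} → N ≤ K → n < 2 ^ N → P K n ≈ P N n
    partialProd-stable {K = zero} z≤n _ = refl
    partialProd-stable {N} {suc K} N≤1+K n<2^N with ℕ.m≤n⇒m<n∨m≡n N≤1+K
    ... | inj₂ ≡.refl     = refl
    ... | inj₁ (s≤s N≤K) =
      trans (partialProd-low K (ℕ.<-≤-trans n<2^N (ℕ.^-monoʳ-≤ 2 N≤K))) (partialProd-stable N≤K n<2^N)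

    infProdCoeff≈partialProd : ∀ N {n} → n < 2 ^ N → infProdCoeff F u n ≈ P N n
    infProdCoeff≈partialProd N {n} n<2^N =
      trans (sym (partialProd-stable (ℕ.m≤n⊔m N (suc n)) (ℕ.<-trans (ℕ.n<1+n n) (n<2^n (suc n)))))
            (partialProd-stable (ℕ.m≤m⊔n N (suc n)) n<2^N)

    partialProd-digits : ∀ N s {x j} → x < 2 ^ N → j < 2 ^ s → P (N + s) (2 ^ s * x + j) ≈ P N x · P s j
    partialProd-digits zero s {zero} {j} _ _ = begin
      P s (2 ^ s * 0 + j) ≡⟨ ≡.cong (λ z → P s (z + j)) (ℕ.*-zeroʳ (2 ^ s)) ⟩
      P s j               ≈⟨ *-identityˡ (P s j) ⟨
      1# · P s j          ∎
    partialProd-digits zero s {suc x} (s≤s ()) _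
    partialProd-digits (suc N) s {x} {j} x<2^[1+N] j<2^s
      with <-+-split (2 ^ N) (≡.subst (x <_) (2^suc≡2^+2^ N) x<2^[1+N])
    ... | inj₁ x<2^N = begin
      P (suc (N + s)) (2 ^ s * x + j) ≈⟨ partialProd-low (N + s) (digits-< N s x<2^N j<2^s) ⟩
      P (N + s) (2 ^ s * x + j)       ≈⟨ partialProd-digits N s x<2^N j<2^s ⟩
      P N x · P s j                   ≈⟨ *-congʳ (partialProd-low N x<2^N) ⟨
      P (suc N) x · P s j             ∎
    ... | inj₂ (y , y<2^N , ≡.refl) = begin
      P (suc (N + s)) (2 ^ s * (2 ^ N + y) + j)       ≡⟨ ≡.cong (P (suc (N + s))) (digits-+ N s y j) ⟩
      P (suc (N + s)) (2 ^ (N + s) + (2 ^ s * y + j)) ≈⟨ partialProd-high (N + s) (digits-< N s y<2^N j<2^s) ⟩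
      P (N + s) (2 ^ s * y + j) · u                   ≈⟨ *-congʳ (partialProd-digits N s y<2^N j<2^s) ⟩
      P N y · P s j · u                               ≈⟨ *-assoc _ _ _ ⟩
      P N y · (P s j · u)                             ≈⟨ *-congˡ (*-comm _ _) ⟩
      P N y · (u · P s j)                             ≈⟨ *-assoc _ _ _ ⟨
      P N y · u · P s j                               ≈⟨ *-congʳ (partialProd-high N y<2^N) ⟨
      P (suc N) (2 ^ N + y) · P s j                   ∎

    private
      A : ℕ → Carrier
      A = infProdCoeff F u

    infProdCoeff-digits : ∀ s x {j} → j < 2 ^ s → A (2 ^ s * x + j) ≈ A x · A j
    infProdCoeff-digits s x {j} j<2^s = begin
      A (2 ^ s * x + j)        ≈⟨ infProdCoeff≈partialProd (x + s) (digits-< x s (n<2^n x) j<2^s) ⟩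
      P (x + s) (2 ^ s * x + j) ≈⟨ partialProd-digits x s (n<2^n x) j<2^s ⟩
      P x x · P s j            ≈⟨ *-cong (infProdCoeff≈partialProd x (n<2^n x)) (infProdCoeff≈partialProd s j<2^s) ⟨
      A x · A j                ∎

    infProdCoeff-0 : A 0 ≈ 1#
    infProdCoeff-0 = infProdCoeff≈partialProd 0 (s≤s z≤n)

    infProdCoeff-1 : A 1 ≈ u
    infProdCoeff-1 = begin
      A 1       ≈⟨ infProdCoeff≈partialProd 1 (s≤s (s≤s z≤n)) ⟩
      P 1 1     ≈⟨ partialProd-high 0 (s≤s z≤n) ⟩
      1# · u    ≈⟨ *-identityˡ u ⟩
      u         ∎

    infProdCoeff-2* : ∀ x → A (2 * x) ≈ A x
    infProdCoeff-2* x = begin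
      A (2 * x)     ≡⟨ ≡.cong A (ℕ.+-identityʳ (2 * x)) ⟨
      A (2 * x + 0) ≈⟨ infProdCoeff-digits 1 x (s≤s z≤n) ⟩
      A x · A 0     ≈⟨ *-congˡ infProdCoeff-0 ⟩
      A x · 1#      ≈⟨ *-identityʳ (A x) ⟩
      A x           ∎

    infProdCoeff-2*+1 : ∀ x → A (2 * x + 1) ≈ u · A x
    infProdCoeff-2*+1 x = begin
      A (2 * x + 1) ≈⟨ infProdCoeff-digits 1 x (s≤s (s≤s z≤n)) ⟩
      A x · A 1     ≈⟨ *-congˡ infProdCoeff-1 ⟩
      A x · u       ≈⟨ *-comm (A x) u ⟩
      u · A x       ∎

    infProdCoeff-allOnes : ∀ v → A (allOnes v) ≈ u ^ᶠ v
    infProdCoeff-allOnes zero    = infProdCoeff-0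
    infProdCoeff-allOnes (suc v) = trans (infProdCoeff-2*+1 (allOnes v)) (*-congˡ (infProdCoeff-allOnes v))

    infProdCoeff-allOnes+1 : ∀ v → A (allOnes v + 1) ≈ u
    infProdCoeff-allOnes+1 zero    = infProdCoeff-1
    infProdCoeff-allOnes+1 (suc v) = begin
      A (2 * allOnes v + 1 + 1) ≡⟨ ≡.cong A (carry (allOnes v)) ⟩
      A (2 * (allOnes v + 1))   ≈⟨ infProdCoeff-2* (allOnes v + 1) ⟩
      A (allOnes v + 1)         ≈⟨ infProdCoeff-allOnes+1 v ⟩
      u                         ∎
      where
        carry : ∀ o → 2 * o + 1 + 1 ≡ 2 * (o + 1)
        carry = solve-∀

    infProdCoeff-carry : ∀ s x {j} → j < 2 ^ s → A (x + 1) ≈ u · A x →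
                         A (2 ^ s * (x + 1) + j) ≈ u · A (2 ^ s * x + j)
    infProdCoeff-carry s x {j} j<2^s A[x+1]≈u·A[x] = begin
      A (2 ^ s * (x + 1) + j) ≈⟨ infProdCoeff-digits s (x + 1) j<2^s ⟩
      A (x + 1) · A j         ≈⟨ *-congʳ A[x+1]≈u·A[x] ⟩
      u · A x · A j           ≈⟨ *-assoc u (A x) (A j) ⟩
      u · (A x · A j)         ≈⟨ *-congˡ (infProdCoeff-digits s x j<2^s) ⟨
      u · A (2 ^ s * x + j)   ∎

    infProdCoeff-shift : ∀ v → u ≈ u ^ᶠ (2 + v) → ∀ M {m} → m < 2 ^ M + 2 ^ M →
                         A (m + 2 ^ M + 2 ^ M * (2 * allOnes v)) ≈ u · A (m + 2 ^ M * (2 * allOnes v))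
    infProdCoeff-shift v u≈u^[2+v] M {m} m<2D = by-cases (<-+-split D m<2D)
      where
        D = 2 ^ M
        x = 2 * allOnes v

        A[x+1]≈u·A[x] : A (x + 1) ≈ u · A x
        A[x+1]≈u·A[x] = trans (infProdCoeff-2*+1 (allOnes v)) (*-congˡ (sym (infProdCoeff-2* (allOnes v))))

        A[x+2]≈u·A[x+1] : A (x + 1 + 1) ≈ u · A (x + 1)
        A[x+2]≈u·A[x+1] = begin
          A (x + 1 + 1)    ≈⟨ infProdCoeff-allOnes+1 (suc v) ⟩
          u                ≈⟨ u≈u^[2+v] ⟩
          u · (u · u ^ᶠ v) ≈⟨ *-congˡ (infProdCoeff-allOnes (suc v)) ⟨
          u · A (x + 1)    ∎

        reorder₁ : ∀ m D x → m + D + D * x ≡ D * (x + 1) + m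
        reorder₁ = solve-∀
        reorder₂ : ∀ j D x → D + j + D + D * x ≡ D * (x + 1 + 1) + j
        reorder₂ = solve-∀
        reorder₃ : ∀ j D x → D * (x + 1) + j ≡ D + j + D * x
        reorder₃ = solve-∀

        by-cases : m < D ⊎ ∃ (λ j → j < D × D + j ≡ m) → A (m + D + D * x) ≈ u · A (m + D * x)
        by-cases (inj₁ m<D) = begin
          A (m + D + D * x)       ≡⟨ ≡.cong A (reorder₁ m D x) ⟩
          A (D * (x + 1) + m)     ≈⟨ infProdCoeff-carry M x m<D A[x+1]≈u·A[x] ⟩
          u · A (D * x + m)       ≡⟨ ≡.cong (λ i → u · A i) (ℕ.+-comm (D * x) m) ⟩
          u · A (m + D * x)       ∎
        by-cases (inj₂ (j , j<D , ≡.refl)) = begin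
          A (D + j + D + D * x)   ≡⟨ ≡.cong A (reorder₂ j D x) ⟩
          A (D * (x + 1 + 1) + j) ≈⟨ infProdCoeff-carry M (x + 1) j<D A[x+2]≈u·A[x+1] ⟩
          u · A (D * (x + 1) + j) ≡⟨ ≡.cong (λ i → u · A i) (reorder₃ j D x) ⟩
          u · A (D + j + D * x)   ∎

    g-binomial-vanishes : ∀ v → u ≈ u ^ᶠ (2 + v) → ∀ M {m} → m < 2 ^ M + 2 ^ M →
                          fracCoeff F (binomial (2 ^ M) u) (2 ^ M) (2 ^ M * (2 * allOnes v)) (g F u) (suc m) ≈ 0#
    g-binomial-vanishes v u≈u^[2+v] M {m} m<2D = begin
      fracCoeff F (binomial D u) D k (g F u) (suc m) ≈⟨ fracCoeff-binomial u k (g F u) (suc m) (2^n≢0 M) ⟩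
      A (m + D + k) - u · A (m + k)                  ≈⟨ +-congʳ (infProdCoeff-shift v u≈u^[2+v] M m<2D) ⟩
      u · A (m + k) - u · A (m + k)                  ≈⟨ -‿inverseʳ _ ⟩
      0#                                             ∎
      where
        D = 2 ^ M
        k = D * (2 * allOnes v)

    power-periodic⇒¬ELC : ¬ (0# ≈ 1#) → (∃ λ v → u ≈ u ^ᶠ (2 + v)) → ¬ ELC F (g F u)
    power-periodic⇒¬ELC 0≉1 (v , u≈u^[2+v]) (M , elc) with elc D q q[D]≉0 (D * (2 * allOnes v))
      where
        D = 2 ^ M
        q = binomial D u
        q[D]≉0 : ¬ q D ≈ 0#
        q[D]≉0 q[D]≈0 = 0≉1 (trans (sym q[D]≈0) (binomial-leading D u (2^n≢0 M)))
    ... | suc m , _ , 1+m≤D+M , nonzero =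
      nonzero (g-binomial-vanishes v u≈u^[2+v] M (ℕ.≤-trans 1+m≤D+M (ℕ.+-monoʳ-≤ (2 ^ M) (ℕ.<⇒≤ (n<2^n M)))))

theorem3 : ∀ {c ℓ : Level} (F : CommutativeRing c ℓ) → IsField F → Finite F →
             (u : CommutativeRing.Carrier F) → ¬ ELC F (g F u)
theorem3 F isField@(0≉1 , _) finite u elc =
  finite-field-power-periodic F isField finite u λ periodic → power-periodic⇒¬ELC F u 0≉1 periodic elc
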